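{- Let $G(x)=\sum_{n\ge 0}G_n x^n$ and $\widehat F(x)=\sum_{n\ge0}\widehat F_n x^n$ be formal power series with complex coefficients, with $G_0=1$ and $\widehat F_0\neq 0$, and put $F(x)=x\,\widehat F(x)$. Define the Riordan triangle $R=(G,F)$ by $$\sum_{n\ge 0}R(n,m)\,x^n=G(x)\,F(x)^m\qquad(m\ge 0),$$ so that $R(n,m)=0$ for $n<m$. For $d\ge 0$ and $m\ge 0$ let $\widehat D(d,m)=\binom{d+m}{m}R(d+m,m)$, let $G\widehat D(d,t)=\sum_{m\ge0}\widehat D(d,m)\,t^m$, and let $$LG\widehat DR(y,t)=\sum_{d\ge 0} G\widehat D(d,t)\,\frac{y^{d+1}}{d+1}.$$ Let $x(t;y)$ be the compositional inverse, with respect to $x$, of $y(t;x)=x-t\,F(x)$, i.e. the unique formal power series $x(t;y)\in\mathbb C[[t,y]]$ with zero constant term satisfying $x(t;y)-t\,F(x(t;y))=y$. Let $H(x)=\int G(x)\,dx$ be an antiderivative of $G$. Then $$LG\widehat DR(y,t)=H(x(t;y))-H(0)=\sum_{n\ge0}G_n\,\frac{x(t;y)^{n+1}}{n+1}.$$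
   Context: All series are formal power series; no convergence questions are considered. $\binom{d+m}{m}$ is the binomial coefficient, i.e. the entry of Pascal's triangle in row $d+m$, column $m$. -}

module Defs where

open import Level using (Level; _⊔_)
open import Data.Nat using (ℕ; zero; suc) renaming (_+_ to _+ℕ_; _∸_ to _∸ℕ_)
open import Data.Nat.Combinatorics using (_C_)
open import Algebra.Bundles using (CommutativeRing)
open import Relation.Nullary using (¬_)

ringFromℕ : {c ℓ : Level} (R : CommutativeRing c ℓ) → ℕ → CommutativeRing.Carrier R
ringFromℕ R zero    = CommutativeRing.0# R
ringFromℕ R (suc n) = CommutativeRing._+_ R (CommutativeRing.1# R) (ringFromℕ R n)

-- A field of characteristic zero (stand-in for ℂ).
record CharZeroField (c ℓ : Level) : Set (Level.suc (c ⊔ ℓ)) where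
  field
    cring : CommutativeRing c ℓ
  open CommutativeRing cring public
  field
    inverse      : (x : Carrier) → ¬ (x ≈ 0#) → Carrier
    inverse-law  : (x : Carrier) (p : ¬ (x ≈ 0#)) → x * inverse x p ≈ 1#
    char-zero    : (n : ℕ) → ¬ (ringFromℕ cring (suc n) ≈ 0#)
  fromℕ : ℕ → Carrier
  fromℕ = ringFromℕ cring

module Series {c ℓ : Level} (K : CharZeroField c ℓ) where
  open CharZeroField K

  inv-suc : ℕ → Carrier
  inv-suc n = inverse (fromℕ (suc n)) (char-zero n)

  sumTo : ℕ → (ℕ → Carrier) → Carrier
  sumTo zero    f = 0#
  sumTo (suc n) f = sumTo n f + f n

  Ser : Set c
  Ser = ℕ → Carrier

  _⋆_ : Ser → Ser → Ser
  (f ⋆ g) n = sumTo (suc n) (λ k → f k * g (n ∸ℕ k))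

  one : Ser
  one zero    = 1#
  one (suc _) = 0#

  pow : Ser → ℕ → Ser
  pow f zero    = one
  pow f (suc m) = f ⋆ pow f m

  xTimes : Ser → Ser
  xTimes f zero    = 0#
  xTimes f (suc n) = f n

  riordan : Ser → Ser → ℕ → ℕ → Carrier
  riordan G F n m = (G ⋆ pow F m) n

  Dhat : Ser → Ser → ℕ → ℕ → Carrier
  Dhat G F d m = fromℕ ((d +ℕ m) C m) * riordan G F (d +ℕ m) m

  -- bivariate series in t, y: S i j = coefficient of t^i y^j
  BSer : Set c
  BSer = ℕ → ℕ → Carrier

  -- LGD̂R(y,t) = Σ_d GD̂(d,t) y^(d+1)/(d+1), GD̂(d,t) = Σ_m D̂(d,m) t^m
  LGDR : Ser → Ser → BSer
  LGDR G F i zero    = 0#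
  LGDR G F i (suc d) = Dhat G F d i * inv-suc d

  _⊛_ : BSer → BSer → BSer
  (A ⊛ B) i j = sumTo (suc i) (λ a → sumTo (suc j) (λ b → A a b * B (i ∸ℕ a) (j ∸ℕ b)))

  bone : BSer
  bone zero zero    = 1#
  bone zero (suc _) = 0#
  bone (suc _) _    = 0#

  bpow : BSer → ℕ → BSer
  bpow A zero    = bone
  bpow A (suc k) = A ⊛ bpow A k

  -- f(A) for A with zero constant term: only k ≤ i + j contribute to t^i y^j
  compose : Ser → BSer → BSer
  compose f A i j = sumTo (suc (i +ℕ j)) (λ k → f k * bpow A k i j)

  tTimes : BSer → BSer
  tTimes S zero    j = 0#
  tTimes S (suc i) j = S i j

  ySer : BSer
  ySer zero (suc zero)    = 1#
  ySer zero zero          = 0#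
  ySer zero (suc (suc _)) = 0#
  ySer (suc _) _          = 0#

  bconst : Carrier → BSer
  bconst x zero zero    = x
  bconst x zero (suc _) = 0#
  bconst x (suc _) _    = 0#

  integral : Ser → Ser
  integral G zero    = 0#
  integral G (suc n) = G n * inv-suc n

module Submission where

-- Let X(t;y) solve X - t·F(X) = y with F = x·F̂.  The core is the coefficient
-- form of Lagrange inversion (`inversion`):
--     i! · j! · [tⁱ yʲ] X^(k+1) = (k+1) · (i+j-1)! · [xʲ] x^(k+1) F̂(x)ⁱ ,
-- proved by induction on (i, j) from the recurrence X^(k+1) = y·X^k + t·F(X)·X^k
-- and the Euler-operator identities θ(F̂^(i+1)) = (i+1)·θF̂·F̂ⁱ and
-- θ(x^k g) = x^k θg + k·x^k g  (θ = x·d/dx).  Summing it against the coefficients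
-- G_k/(k+1) of ∫G gives i!(j+1)!·[tⁱ y^(j+1)] (∫G)(X) = (i+j)!·[xʲ] G F̂ⁱ, which is
-- also i!(j+1)! times the coefficient of LGD̂R since R(j+i,i) = [xʲ] G F̂ⁱ; an
-- antiderivative H differs from ∫G only in its constant term.

open import Defs
open import Level using (Level)
open import Data.Nat
  using (ℕ; zero; suc; _∸_; _≤_; _<_; z≤n; s≤s; _!; NonZero)
  renaming (_+_ to _+ℕ_; _*_ to _*ℕ_)
import Data.Nat.Properties as ℕP
open import Data.Nat.Properties using (_!*_!≢0)
open import Data.Nat.Combinatorics using (_C_; nCk≡n!/k![n-k]!; k![n∸k]!∣n!)
open import Data.Nat.DivMod using (m*[n/m]≡n)
open import Data.Product using (_×_; _,_)
open import Relation.Nullary using (¬_)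
open import Relation.Binary.PropositionalEquality as P using (_≡_)
open import Algebra.Bundles using (CommutativeRing)
open import Algebra.Structures using (IsCommutativeRing)
import Algebra.Properties.CommutativeSemigroup as CommSemigroupProperties
import Algebra.Properties.Group as GroupProperties
import Relation.Binary.Reasoning.Setoid as SetoidReasoning

factorials-binomial : ∀ {n k} → k ≤ n → k ! *ℕ (n ∸ k) ! *ℕ (n C k) ≡ n !
factorials-binomial {n} {k} k≤n =
  P.trans (P.cong (k ! *ℕ (n ∸ k) ! *ℕ_) (nCk≡n!/k![n-k]! k≤n)) (m*[n/m]≡n (k![n∸k]!∣n! k≤n))
  where instance _ = k !* (n ∸ k) !≢0

degree-drop : ∀ a b a₁ b₁ m → a₁ ≤ a → b₁ ≤ b → a +ℕ b < suc m → 1 ≤ a₁ +ℕ b₁ →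
              (a ∸ a₁) +ℕ (b ∸ b₁) < m
degree-drop a b a₁ b₁ m a₁≤a b₁≤b a+b≤m 1≤a₁+b₁ = begin
  suc (u +ℕ v)              ≡⟨ ℕP.+-comm 1 (u +ℕ v) ⟩
  (u +ℕ v) +ℕ 1             ≤⟨ ℕP.+-monoʳ-≤ (u +ℕ v) 1≤a₁+b₁ ⟩
  (u +ℕ v) +ℕ (a₁ +ℕ b₁)    ≡⟨ interchange u v a₁ b₁ ⟩
  (u +ℕ a₁) +ℕ (v +ℕ b₁)    ≡⟨ P.cong₂ _+ℕ_ (ℕP.m∸n+n≡m a₁≤a) (ℕP.m∸n+n≡m b₁≤b) ⟩
  a +ℕ b                    ≤⟨ ℕP.≤-pred a+b≤m ⟩
  m                         ∎
  where
  open ℕP.≤-Reasoning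
  open CommSemigroupProperties ℕP.+-commutativeSemigroup using (interchange)
  u = a ∸ a₁
  v = b ∸ b₁

module FiniteSums {c ℓ : Level} (R : CommutativeRing c ℓ) where
  open CommutativeRing R hiding (zero)
  open SetoidReasoning setoid
  open CommSemigroupProperties +-commutativeSemigroup using (interchange)

  Σ : ℕ → (ℕ → Carrier) → Carrier
  Σ zero    f = 0#
  Σ (suc n) f = Σ n f + f n

  Σ-cong< : ∀ n {f g : ℕ → Carrier} → (∀ k → k < n → f k ≈ g k) → Σ n f ≈ Σ n g
  Σ-cong< zero    h = refl
  Σ-cong< (suc n) h = +-cong (Σ-cong< n (λ k k<n → h k (ℕP.m<n⇒m<1+n k<n))) (h n ℕP.≤-refl)

  Σ-cong : ∀ n {f g : ℕ → Carrier} → (∀ k → f k ≈ g k) → Σ n f ≈ Σ n g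
  Σ-cong n h = Σ-cong< n (λ k _ → h k)

  Σ-zero : ∀ n {f : ℕ → Carrier} → (∀ k → k < n → f k ≈ 0#) → Σ n f ≈ 0#
  Σ-zero zero    h = refl
  Σ-zero (suc n) h =
    trans (+-cong (Σ-zero n (λ k k<n → h k (ℕP.m<n⇒m<1+n k<n))) (h n ℕP.≤-refl)) (+-identityˡ 0#)

  Σ-+ : ∀ n (f g : ℕ → Carrier) → Σ n (λ k → f k + g k) ≈ Σ n f + Σ n g
  Σ-+ zero    f g = sym (+-identityˡ 0#)
  Σ-+ (suc n) f g = trans (+-congʳ (Σ-+ n f g)) (interchange _ _ _ _)

  Σ-*ˡ : ∀ n (a : Carrier) (f : ℕ → Carrier) → a * Σ n f ≈ Σ n (λ k → a * f k)
  Σ-*ˡ zero    a f = zeroʳ a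
  Σ-*ˡ (suc n) a f = trans (distribˡ a _ _) (+-congʳ (Σ-*ˡ n a f))

  Σ-*ʳ : ∀ n (a : Carrier) (f : ℕ → Carrier) → Σ n f * a ≈ Σ n (λ k → f k * a)
  Σ-*ʳ n a f = trans (*-comm _ _) (trans (Σ-*ˡ n a f) (Σ-cong n (λ k → *-comm _ _)))

  Σ-suc : ∀ n (f : ℕ → Carrier) → Σ (suc n) f ≈ f 0 + Σ n (λ k → f (suc k))
  Σ-suc zero    f = +-comm _ _
  Σ-suc (suc n) f = trans (+-congʳ (Σ-suc n f)) (+-assoc _ _ _)

  Σ-swap : ∀ n m (f : ℕ → ℕ → Carrier) →
           Σ n (λ a → Σ m (λ b → f a b)) ≈ Σ m (λ b → Σ n (λ a → f a b))
  Σ-swap zero    m f = sym (Σ-zero m (λ _ _ → refl))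
  Σ-swap (suc n) m f = trans (+-congʳ (Σ-swap n m f)) (sym (Σ-+ m _ _))

  Σ-extend : ∀ n N (f : ℕ → Carrier) → n ≤ N → (∀ k → n ≤ k → k < N → f k ≈ 0#) → Σ N f ≈ Σ n f
  Σ-extend n N f n≤N h = P.subst (λ M → Σ M f ≈ Σ n f) (ℕP.m∸n+n≡m n≤N)
    (padding (N ∸ n) (λ k p q → h k p (P.subst (k <_) (ℕP.m∸n+n≡m n≤N) q)))
    where
    padding : ∀ d → (∀ k → n ≤ k → k < d +ℕ n → f k ≈ 0#) → Σ (d +ℕ n) f ≈ Σ n f
    padding zero    h = refl
    padding (suc d) h = trans (+-cong (padding d (λ k p q → h k p (ℕP.m<n⇒m<1+n q)))
                                      (h (d +ℕ n) (ℕP.m≤n+m n d) ℕP.≤-refl))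
                              (+-identityʳ _)

  Σ-reverse : ∀ n (f : ℕ → Carrier) → Σ (suc n) f ≈ Σ (suc n) (λ k → f (n ∸ k))
  Σ-reverse zero    f = refl
  Σ-reverse (suc n) f = begin
    Σ (suc n) f + f (suc n)                   ≈⟨ +-congʳ (Σ-reverse n f) ⟩
    Σ (suc n) (λ k → f (n ∸ k)) + f (suc n)   ≈⟨ +-comm _ _ ⟩
    f (suc n) + Σ (suc n) (λ k → f (n ∸ k))   ≈⟨ Σ-suc (suc n) (λ k → f (suc n ∸ k)) ⟨
    Σ (suc (suc n)) (λ k → f (suc n ∸ k))     ∎

  Σ-triangle : ∀ n (h : ℕ → ℕ → Carrier) →
    Σ (suc n) (λ k → Σ (suc k) (λ l → h l (k ∸ l))) ≈ Σ (suc n) (λ l → Σ (suc (n ∸ l)) (λ m → h l m))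
  Σ-triangle zero    h = refl
  Σ-triangle (suc n) h = begin
    Σ (suc n) (λ k → Σ (suc k) (λ l → h l (k ∸ l))) + Σ (suc (suc n)) (λ l → h l (suc n ∸ l))
      ≈⟨ +-cong (Σ-triangle n h) (+-cong (Σ-cong< (suc n) (λ l l<sn → reflexive (P.cong (h l) (sn∸l l<sn))))
                                          (reflexive (P.cong (h (suc n)) (ℕP.n∸n≡0 n)))) ⟩
    Σ (suc n) (λ l → Σ (suc (n ∸ l)) (h l)) + (Σ (suc n) (λ l → h l (suc (n ∸ l))) + h (suc n) 0)
      ≈⟨ +-assoc _ _ _ ⟨
    (Σ (suc n) (λ l → Σ (suc (n ∸ l)) (h l)) + Σ (suc n) (λ l → h l (suc (n ∸ l)))) + h (suc n) 0
      ≈⟨ +-cong (Σ-+ (suc n) _ _) (+-identityˡ _) ⟨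
    Σ (suc n) (λ l → Σ (suc (suc (n ∸ l))) (h l)) + Σ 1 (h (suc n))
      ≈⟨ +-cong (Σ-cong< (suc n) (λ l l<sn → reflexive (P.cong (λ M → Σ (suc M) (h l)) (P.sym (sn∸l l<sn)))))
                (reflexive (P.cong (λ M → Σ (suc M) (h (suc n))) (P.sym (ℕP.n∸n≡0 n)))) ⟩
    Σ (suc n) (λ l → Σ (suc (suc n ∸ l)) (h l)) + Σ (suc (suc n ∸ suc n)) (h (suc n)) ∎
    where
    sn∸l : ∀ {l} → l < suc n → suc n ∸ l ≡ suc (n ∸ l)
    sn∸l l<sn = ℕP.+-∸-assoc 1 (ℕP.≤-pred l<sn)

module PowerSeries {c ℓ : Level} (R : CommutativeRing c ℓ) where
  open CommutativeRing R hiding (zero)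
  open FiniteSums R public
  open SetoidReasoning setoid

  Ser : Set c
  Ser = ℕ → Carrier

  infix 4 _≈s_
  _≈s_ : Ser → Ser → Set ℓ
  f ≈s g = ∀ n → f n ≈ g n

  _+s_ : Ser → Ser → Ser
  (f +s g) n = f n + g n

  -s_ : Ser → Ser
  (-s f) n = - f n

  0s : Ser
  0s _ = 0#

  one : Ser
  one zero    = 1#
  one (suc _) = 0#

  _·s_ : Carrier → Ser → Ser
  (a ·s f) n = a * f n

  _⋆_ : Ser → Ser → Ser
  (f ⋆ g) n = Σ (suc n) (λ k → f k * g (n ∸ k))

  ⋆-cong : ∀ {f f′ g g′} → f ≈s f′ → g ≈s g′ → f ⋆ g ≈s f′ ⋆ g′
  ⋆-cong p q n = Σ-cong (suc n) (λ k → *-cong (p k) (q (n ∸ k)))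

  ⋆-congˡ : ∀ f {g g′} → g ≈s g′ → f ⋆ g ≈s f ⋆ g′
  ⋆-congˡ f = ⋆-cong (λ _ → refl)

  ⋆-comm : ∀ f g → f ⋆ g ≈s g ⋆ f
  ⋆-comm f g n = trans (Σ-reverse n _) (Σ-cong< (suc n) (λ k k<sn →
    trans (*-comm _ _) (*-congʳ (reflexive (P.cong g (ℕP.m∸[m∸n]≡n (ℕP.≤-pred k<sn)))))))

  ⋆-assoc : ∀ f g h → (f ⋆ g) ⋆ h ≈s f ⋆ (g ⋆ h)
  ⋆-assoc f g h n = begin
    Σ (suc n) (λ k → Σ (suc k) (λ l → f l * g (k ∸ l)) * h (n ∸ k))
      ≈⟨ Σ-cong< (suc n) (λ k _ → trans (Σ-*ʳ (suc k) _ _) (Σ-cong< (suc k) (λ l l<sk →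
           trans (*-assoc _ _ _) (*-congˡ (*-congˡ (reflexive (P.cong h (split k l (ℕP.≤-pred l<sk))))))))) ⟩
    Σ (suc n) (λ k → Σ (suc k) (λ l → f l * (g (k ∸ l) * h (n ∸ l ∸ (k ∸ l)))))
      ≈⟨ Σ-triangle n (λ l m → f l * (g m * h (n ∸ l ∸ m))) ⟩
    Σ (suc n) (λ l → Σ (suc (n ∸ l)) (λ m → f l * (g m * h (n ∸ l ∸ m))))
      ≈⟨ Σ-cong (suc n) (λ l → Σ-*ˡ (suc (n ∸ l)) _ _) ⟨
    Σ (suc n) (λ l → f l * Σ (suc (n ∸ l)) (λ m → g m * h (n ∸ l ∸ m))) ∎
    where
    split : ∀ k l → l ≤ k → n ∸ k ≡ n ∸ l ∸ (k ∸ l)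
    split k l l≤k = P.trans (P.cong (n ∸_) (P.sym (ℕP.m+[n∸m]≡n l≤k))) (P.sym (ℕP.∸-+-assoc n l (k ∸ l)))

  ⋆-distribʳ : ∀ f g h → (f +s g) ⋆ h ≈s (f ⋆ h) +s (g ⋆ h)
  ⋆-distribʳ f g h n = trans (Σ-cong (suc n) (λ k → distribʳ _ _ _)) (Σ-+ (suc n) _ _)

  ⋆-identityˡ : ∀ f → one ⋆ f ≈s f
  ⋆-identityˡ f n =
    trans (Σ-suc n _) (trans (+-cong (*-identityˡ _) (Σ-zero n (λ k _ → zeroˡ _))) (+-identityʳ _))

  ⋆-scaleˡ : ∀ a f g → (a ·s f) ⋆ g ≈s a ·s (f ⋆ g)
  ⋆-scaleˡ a f g n = trans (Σ-cong (suc n) (λ k → *-assoc _ _ _)) (sym (Σ-*ˡ (suc n) _ _))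

  ⋆-scaleʳ : ∀ a f g → f ⋆ (a ·s g) ≈s a ·s (f ⋆ g)
  ⋆-scaleʳ a f g n = trans (⋆-comm f _ n) (trans (⋆-scaleˡ a g f n) (*-congˡ (⋆-comm g f n)))

  serRing : CommutativeRing c ℓ
  serRing = record { isCommutativeRing = isCommutativeRingˢ }
    where
    ⋆-identityʳ : ∀ f → f ⋆ one ≈s f
    ⋆-identityʳ f n = trans (⋆-comm f one n) (⋆-identityˡ f n)

    ⋆-distribˡ : ∀ f g h → f ⋆ (g +s h) ≈s (f ⋆ g) +s (f ⋆ h)
    ⋆-distribˡ f g h n =
      trans (⋆-comm f _ n) (trans (⋆-distribʳ g h f n) (+-cong (⋆-comm g f n) (⋆-comm h f n)))

    isCommutativeRingˢ : IsCommutativeRing _≈s_ _+s_ _⋆_ -s_ 0s one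
    isCommutativeRingˢ = record
      { isRing = record
        { +-isAbelianGroup = record
          { isGroup = record
            { isMonoid = record
              { isSemigroup = record
                { isMagma = record
                  { isEquivalence = record
                    { refl = λ n → refl ; sym = λ p n → sym (p n) ; trans = λ p q n → trans (p n) (q n) }
                  ; ∙-cong = λ p q n → +-cong (p n) (q n) }
                ; assoc = λ f g h n → +-assoc _ _ _ }
              ; identity = (λ f n → +-identityˡ _) , (λ f n → +-identityʳ _) }
            ; inverse = (λ f n → -‿inverseˡ _) , (λ f n → -‿inverseʳ _)
            ; ⁻¹-cong = λ p n → -‿cong (p n) }
          ; comm = λ f g n → +-comm _ _ }
        ; *-cong = ⋆-cong
        ; *-assoc = ⋆-assoc
        ; *-identity = ⋆-identityˡ , ⋆-identityʳ
        ; distrib = ⋆-distribˡ , (λ h f g → ⋆-distribʳ f g h) }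
      ; *-comm = ⋆-comm }

  const : Carrier → Ser
  const a zero    = a
  const a (suc _) = 0#

  const-⋆ : ∀ a f → const a ⋆ f ≈s a ·s f
  const-⋆ a f n = trans (Σ-suc n _) (trans (+-congˡ (Σ-zero n (λ k _ → zeroˡ _))) (+-identityʳ _))

  xMul : Ser → Ser
  xMul f zero    = 0#
  xMul f (suc n) = f n

  xMul-cong : ∀ {f g} → f ≈s g → xMul f ≈s xMul g
  xMul-cong p zero    = refl
  xMul-cong p (suc n) = p n

  xMul-⋆ : ∀ f g → xMul f ⋆ g ≈s xMul (f ⋆ g)
  xMul-⋆ f g zero    = trans (+-identityˡ _) (zeroˡ _)
  xMul-⋆ f g (suc n) = trans (Σ-suc (suc n) _) (trans (+-congʳ (zeroˡ _)) (+-identityˡ _))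

  xMulPow : ℕ → Ser → Ser
  xMulPow zero    f = f
  xMulPow (suc k) f = xMul (xMulPow k f)

  xMulPow-cong : ∀ k {f g} → f ≈s g → xMulPow k f ≈s xMulPow k g
  xMulPow-cong zero    p = p
  xMulPow-cong (suc k) p = xMul-cong (xMulPow-cong k p)

  xMulPow-⋆ : ∀ k f g → xMulPow k f ⋆ g ≈s xMulPow k (f ⋆ g)
  xMulPow-⋆ zero    f g n = refl
  xMulPow-⋆ (suc k) f g n = trans (xMul-⋆ (xMulPow k f) g n) (xMul-cong (xMulPow-⋆ k f g) n)

  xMulPow-≤ : ∀ m j (g : Ser) → m ≤ j → xMulPow m g j ≡ g (j ∸ m)
  xMulPow-≤ zero    j       g _         = P.refl
  xMulPow-≤ (suc m) (suc j) g (s≤s m≤j) = xMulPow-≤ m j g m≤j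

  xMulPow-< : ∀ m j (g : Ser) → j < m → xMulPow m g j ≡ 0#
  xMulPow-< (suc m) zero    g _         = P.refl
  xMulPow-< (suc m) (suc j) g (s≤s j<m) = xMulPow-< m j g j<m

  xMulPow-+ : ∀ k f g → xMulPow k (f +s g) ≈s xMulPow k f +s xMulPow k g
  xMulPow-+ zero    f g j       = refl
  xMulPow-+ (suc k) f g zero    = sym (+-identityˡ _)
  xMulPow-+ (suc k) f g (suc j) = xMulPow-+ k f g j

  xMulPow-scale : ∀ k a f → xMulPow k (a ·s f) ≈s a ·s xMulPow k f
  xMulPow-scale zero    a f j       = refl
  xMulPow-scale (suc k) a f zero    = sym (zeroʳ _)
  xMulPow-scale (suc k) a f (suc j) = xMulPow-scale k a f j

  xMulPow-Σ : ∀ k N (a g : Ser) j → suc j ≤ k +ℕ N →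
              Σ N (λ m → a m * xMulPow (k +ℕ m) g j) ≈ xMulPow k (a ⋆ g) j
  xMulPow-Σ zero N a g j le = begin
    Σ N (λ m → a m * xMulPow m g j)
      ≈⟨ Σ-extend (suc j) N _ le (λ m j<m _ → trans (*-congˡ (reflexive (xMulPow-< m j g j<m))) (zeroʳ _)) ⟩
    Σ (suc j) (λ m → a m * xMulPow m g j)
      ≈⟨ Σ-cong< (suc j) (λ m m<sj → reflexive (P.cong (a m *_) (xMulPow-≤ m j g (ℕP.≤-pred m<sj)))) ⟩
    (a ⋆ g) j ∎
  xMulPow-Σ (suc k) N a g zero    le       = Σ-zero N (λ m _ → zeroʳ _)
  xMulPow-Σ (suc k) N a g (suc j) (s≤s le) = xMulPow-Σ k N a g j le

  pow : Ser → ℕ → Ser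
  pow f zero    = one
  pow f (suc m) = f ⋆ pow f m

  pow-cong : ∀ {f g} m → f ≈s g → pow f m ≈s pow g m
  pow-cong zero    p n = refl
  pow-cong (suc m) p   = ⋆-cong p (pow-cong m p)

  pow-+ : ∀ f a b → pow f (a +ℕ b) ≈s pow f a ⋆ pow f b
  pow-+ f zero    b n = sym (⋆-identityˡ (pow f b) n)
  pow-+ f (suc a) b n = trans (⋆-congˡ f (pow-+ f a b) n) (sym (⋆-assoc f (pow f a) (pow f b) n))

  pow-xMul : ∀ f i → pow (xMul f) i ≈s xMulPow i (pow f i)
  pow-xMul f zero    n = refl
  pow-xMul f (suc i) n = begin
    (xMul f ⋆ pow (xMul f) i) n      ≈⟨ ⋆-congˡ (xMul f) (pow-xMul f i) n ⟩
    (xMul f ⋆ xMulPow i (pow f i)) n ≈⟨ xMul-⋆ f (xMulPow i (pow f i)) n ⟩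
    xMul (f ⋆ xMulPow i (pow f i)) n ≈⟨ xMul-cong (λ m → trans (⋆-comm f _ m)
                                          (trans (xMulPow-⋆ i (pow f i) f m)
                                                 (xMulPow-cong i (⋆-comm (pow f i) f) m))) n ⟩
    xMul (xMulPow i (f ⋆ pow f i)) n ∎

  ℕ→ : ℕ → Carrier
  ℕ→ = ringFromℕ R

  ℕ→-+ : ∀ a b → ℕ→ (a +ℕ b) ≈ ℕ→ a + ℕ→ b
  ℕ→-+ zero    b = sym (+-identityˡ _)
  ℕ→-+ (suc a) b = trans (+-congˡ (ℕ→-+ a b)) (sym (+-assoc _ _ _))

  ℕ→-* : ∀ a b → ℕ→ (a *ℕ b) ≈ ℕ→ a * ℕ→ b
  ℕ→-* zero    b = sym (zeroˡ _)
  ℕ→-* (suc a) b =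
    trans (ℕ→-+ b (a *ℕ b)) (trans (+-cong (sym (*-identityˡ _)) (ℕ→-* a b)) (sym (distribʳ _ _ _)))

  ℕ→-suc-* : ∀ n a → ℕ→ (suc n) * a ≈ a + ℕ→ n * a
  ℕ→-suc-* n a = trans (distribʳ _ _ _) (+-congʳ (*-identityˡ a))

  θ : Ser → Ser
  θ f n = ℕ→ n * f n

  θ-⋆ : ∀ f g → θ (f ⋆ g) ≈s (θ f ⋆ g) +s (f ⋆ θ g)
  θ-⋆ f g n = begin
    ℕ→ n * Σ (suc n) (λ k → f k * g (n ∸ k))
      ≈⟨ Σ-*ˡ (suc n) _ _ ⟩
    Σ (suc n) (λ k → ℕ→ n * (f k * g (n ∸ k)))
      ≈⟨ Σ-cong< (suc n) (λ k k<sn → trans (*-congʳ (degree-split k (ℕP.≤-pred k<sn))) (leibniz _ _ _ _)) ⟩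
    Σ (suc n) (λ k → ℕ→ k * f k * g (n ∸ k) + f k * (ℕ→ (n ∸ k) * g (n ∸ k)))
      ≈⟨ Σ-+ (suc n) _ _ ⟩
    (θ f ⋆ g) n + (f ⋆ θ g) n ∎
    where
    degree-split : ∀ k → k ≤ n → ℕ→ n ≈ ℕ→ k + ℕ→ (n ∸ k)
    degree-split k k≤n = trans (reflexive (P.cong ℕ→ (P.sym (ℕP.m+[n∸m]≡n k≤n)))) (ℕ→-+ k (n ∸ k))
    leibniz : ∀ a b u v → (a + b) * (u * v) ≈ a * u * v + u * (b * v)
    leibniz a b u v = trans (distribʳ _ _ _)
      (+-cong (sym (*-assoc _ _ _)) (trans (sym (*-assoc _ _ _)) (trans (*-congʳ (*-comm _ _)) (*-assoc _ _ _))))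

  θ-pow : ∀ f i → θ (pow f (suc i)) ≈s ℕ→ (suc i) ·s (θ f ⋆ pow f i)
  θ-pow f zero n = begin
    ℕ→ n * (f ⋆ one) n            ≈⟨ *-congˡ (trans (⋆-comm f one n) (⋆-identityˡ f n)) ⟩
    θ f n                         ≈⟨ trans (⋆-comm (θ f) one n) (⋆-identityˡ (θ f) n) ⟨
    (θ f ⋆ one) n                 ≈⟨ *-identityˡ _ ⟨
    1# * (θ f ⋆ one) n            ≈⟨ *-congʳ (+-identityʳ 1#) ⟨
    ℕ→ 1 * (θ f ⋆ one) n          ∎
  θ-pow f (suc i) n = begin
    θ (f ⋆ fⁱ⁺¹) n
      ≈⟨ θ-⋆ f fⁱ⁺¹ n ⟩
    (θ f ⋆ fⁱ⁺¹) n + (f ⋆ θ fⁱ⁺¹) n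
      ≈⟨ +-congˡ (⋆-congˡ f (θ-pow f i) n) ⟩
    (θ f ⋆ fⁱ⁺¹) n + (f ⋆ (ℕ→ (suc i) ·s (θ f ⋆ fⁱ))) n
      ≈⟨ +-congˡ (⋆-scaleʳ (ℕ→ (suc i)) f (θ f ⋆ fⁱ) n) ⟩
    (θ f ⋆ fⁱ⁺¹) n + ℕ→ (suc i) * (f ⋆ (θ f ⋆ fⁱ)) n
      ≈⟨ +-congˡ (*-congˡ (swap f (θ f) fⁱ n)) ⟩
    (θ f ⋆ fⁱ⁺¹) n + ℕ→ (suc i) * (θ f ⋆ fⁱ⁺¹) n
      ≈⟨ ℕ→-suc-* (suc i) _ ⟨
    ℕ→ (suc (suc i)) * (θ f ⋆ fⁱ⁺¹) n ∎
    where
    fⁱ = pow f i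
    fⁱ⁺¹ = pow f (suc i)
    open CommSemigroupProperties (CommutativeRing.*-commutativeSemigroup serRing)
      renaming (x∙yz≈y∙xz to swap)

  xMulPow-θ : ∀ k g j → xMulPow k (θ g) j + ℕ→ k * xMulPow k g j ≈ ℕ→ j * xMulPow k g j
  xMulPow-θ zero    g j       = trans (+-congˡ (zeroˡ _)) (+-identityʳ _)
  xMulPow-θ (suc k) g zero    = trans (+-identityˡ _) (trans (zeroʳ _) (sym (zeroʳ _)))
  xMulPow-θ (suc k) g (suc j) = begin
    xMulPow k (θ g) j + ℕ→ (suc k) * e  ≈⟨ +-congˡ (ℕ→-suc-* k e) ⟩
    xMulPow k (θ g) j + (e + ℕ→ k * e)  ≈⟨ +-congˡ (+-comm _ _) ⟩
    xMulPow k (θ g) j + (ℕ→ k * e + e)  ≈⟨ +-assoc _ _ _ ⟨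
    (xMulPow k (θ g) j + ℕ→ k * e) + e  ≈⟨ +-congʳ (xMulPow-θ k g j) ⟩
    ℕ→ j * e + e                        ≈⟨ +-comm _ _ ⟩
    e + ℕ→ j * e                        ≈⟨ ℕ→-suc-* j e ⟨
    ℕ→ (suc j) * e                      ∎
    where e = xMulPow k g j

  xMulPow-one-degree : ∀ m j → ℕ→ j * xMulPow m one j ≈ ℕ→ m * xMulPow m one j
  xMulPow-one-degree zero    zero    = refl
  xMulPow-one-degree zero    (suc j) = trans (zeroʳ _) (sym (zeroʳ _))
  xMulPow-one-degree (suc m) zero    = trans (zeroˡ _) (sym (zeroʳ _))
  xMulPow-one-degree (suc m) (suc j) =
    trans (ℕ→-suc-* j e) (trans (+-congˡ (xMulPow-one-degree m j)) (sym (ℕ→-suc-* m e)))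
    where e = xMulPow m one j

-- Everything below works over a field of characteristic zero; U and B are the
-- univariate and bivariate series rings over it.
module Inversion {c ℓ : Level} (K : CharZeroField c ℓ) where
  open CharZeroField K hiding (zero)
  module S = Series K
  module U = PowerSeries cring
  module B = PowerSeries U.serRing
  open U using (ℕ→; ℕ→-+; ℕ→-*; Σ; Σ-cong; Σ-cong<; Σ-zero; Σ-suc; Σ-*ˡ)
  open SetoidReasoning setoid
  open CommSemigroupProperties *-commutativeSemigroup using (x∙yz≈y∙xz; xy∙z≈y∙xz)
  open import Algebra.Solver.Ring.NaturalCoefficients.Default commutativeSemiring
    using (solve; _:+_; _:*_; _:=_; con)

  cancel-ℕ : ∀ n .{{_ : NonZero n}} {a b} → ℕ→ n * a ≈ ℕ→ n * b → a ≈ b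
  cancel-ℕ (suc n) {a} {b} h = trans (sym (undo a)) (trans (*-congˡ h) (undo b))
    where
    u = inverse (ℕ→ (suc n)) (char-zero n)
    undo : ∀ x → u * (ℕ→ (suc n) * x) ≈ x
    undo x = trans (sym (*-assoc _ _ _))
      (trans (*-congʳ (trans (*-comm _ _) (inverse-law _ (char-zero n)))) (*-identityˡ x))

  inv-suc-cancel : ∀ n a → ℕ→ (suc n) * (a * S.inv-suc n) ≈ a
  inv-suc-cancel n a = trans (x∙yz≈y∙xz _ _ _)
    (trans (*-congˡ (inverse-law _ (char-zero n))) (*-identityʳ a))

  fact : ℕ → Carrier
  fact n = ℕ→ (n !)

  fact-zero : fact 0 ≈ 1#
  fact-zero = +-identityʳ 1#

  fact-suc : ∀ n → fact (suc n) ≈ ℕ→ (suc n) * fact n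
  fact-suc n = ℕ→-* (suc n) (n !)

  cancel-factorials : ∀ i j {a b} → fact i * fact j * a ≈ fact i * fact j * b → a ≈ b
  cancel-factorials i j h = cancel-ℕ (i ! *ℕ j !) {{i !* j !≢0}}
    (trans (*-congʳ (ℕ→-* (i !) (j !))) (trans h (sym (*-congʳ (ℕ→-* (i !) (j !))))))

  fact-binomial : ∀ i j → fact i * fact j * ℕ→ ((j +ℕ i) C i) ≈ fact (j +ℕ i)
  fact-binomial i j = begin
    fact i * fact j * ℕ→ ((j +ℕ i) C i)    ≈⟨ *-congʳ (ℕ→-* (i !) (j !)) ⟨
    ℕ→ (i ! *ℕ j !) * ℕ→ ((j +ℕ i) C i)    ≈⟨ ℕ→-* (i ! *ℕ j !) _ ⟨
    ℕ→ (i ! *ℕ j ! *ℕ ((j +ℕ i) C i))      ≡⟨ P.cong ℕ→ identity ⟩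
    fact (j +ℕ i)                          ∎
    where
    identity : i ! *ℕ j ! *ℕ ((j +ℕ i) C i) ≡ (j +ℕ i) !
    identity = P.subst (λ d → i ! *ℕ d ! *ℕ ((j +ℕ i) C i) ≡ (j +ℕ i) !) (ℕP.m+n∸n≡m j i)
                       (factorials-binomial (ℕP.m≤n+m i j))

  sumTo≡Σ : ∀ n f → S.sumTo n f ≡ Σ n f
  sumTo≡Σ zero    f = P.refl
  sumTo≡Σ (suc n) f = P.cong (_+ f n) (sumTo≡Σ n f)

  BΣ-at : ∀ n (Fs : ℕ → U.Ser) j → B.Σ n Fs j ≡ Σ n (λ a → Fs a j)
  BΣ-at zero    Fs j = P.refl
  BΣ-at (suc n) Fs j = P.cong (_+ Fs n j) (BΣ-at n Fs j)

  ⊛≈⋆ : ∀ A C i j → (A S.⊛ C) i j ≈ (A B.⋆ C) i j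
  ⊛≈⋆ A C i j = trans (reflexive (sumTo≡Σ (suc i) _))
    (trans (Σ-cong (suc i) (λ a → reflexive (sumTo≡Σ (suc j) _)))
           (reflexive (P.sym (BΣ-at (suc i) _ j))))

  bpow≈pow : ∀ A k i j → S.bpow A k i j ≈ B.pow A k i j
  bpow≈pow A zero    zero    zero    = refl
  bpow≈pow A zero    zero    (suc j) = refl
  bpow≈pow A zero    (suc i) j       = refl
  bpow≈pow A (suc k) i       j       =
    trans (⊛≈⋆ A (S.bpow A k) i j) (B.⋆-congˡ A (bpow≈pow A k) i j)

  pow≈pow : ∀ f m n → S.pow f m n ≈ U.pow f m n
  pow≈pow f zero    zero    = refl
  pow≈pow f zero    (suc n) = refl
  pow≈pow f (suc m) n       = trans (reflexive (sumTo≡Σ (suc n) _)) (U.⋆-congˡ f (pow≈pow f m) n)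

  xTimes≈xMul : ∀ f → S.xTimes f U.≈s U.xMul f
  xTimes≈xMul f zero    = refl
  xTimes≈xMul f (suc n) = refl

  tTimes≈xMul : ∀ A i j → S.tTimes A i j ≈ B.xMul A i j
  tTimes≈xMul A zero    j = refl
  tTimes≈xMul A (suc i) j = refl

  y : B.Ser
  y = B.const (U.xMul U.one)

  ySer≈y : ∀ i j → S.ySer i j ≈ y i j
  ySer≈y zero    zero          = refl
  ySer≈y zero    (suc zero)    = refl
  ySer≈y zero    (suc (suc j)) = refl
  ySer≈y (suc i) j             = refl

  module Lagrange (F̂ : U.Ser) (X : B.Ser) (X₀₀ : X 0 0 ≈ 0#)
    (X-eqn : ∀ i j → X i j - S.tTimes (S.compose (S.xTimes F̂) X) i j ≈ S.ySer i j) where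

    F : U.Ser
    F = S.xTimes F̂

    P : ℕ → B.Ser
    P = B.pow X

    FX : B.Ser
    FX = S.compose F X

    P-low-degree : ∀ m a b → a +ℕ b < m → P m a b ≈ 0#
    P-low-degree (suc m) a b a+b<sm = trans (reflexive (BΣ-at (suc a) _ b))
        (Σ-zero (suc a) (λ a₁ a₁<sa → Σ-zero (suc b) (λ b₁ b₁<sb →
          term a₁ b₁ (ℕP.≤-pred a₁<sa) (ℕP.≤-pred b₁<sb))))
      where
      rest-vanishes : ∀ a₁ b₁ → a₁ ≤ a → b₁ ≤ b → 1 ≤ a₁ +ℕ b₁ →
                      X a₁ b₁ * P m (a ∸ a₁) (b ∸ b₁) ≈ 0#
      rest-vanishes a₁ b₁ a₁≤a b₁≤b pos =
        trans (*-congˡ (P-low-degree m _ _ (degree-drop a b a₁ b₁ m a₁≤a b₁≤b a+b<sm pos))) (zeroʳ _)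
      term : ∀ a₁ b₁ → a₁ ≤ a → b₁ ≤ b → X a₁ b₁ * P m (a ∸ a₁) (b ∸ b₁) ≈ 0#
      term zero     zero     _   _   = trans (*-congʳ X₀₀) (zeroˡ _)
      term zero     (suc b₁) a≤a b≤b = rest-vanishes 0 (suc b₁) a≤a b≤b (s≤s z≤n)
      term (suc a₁) b₁       a≤a b≤b = rest-vanishes (suc a₁) b₁ a≤a b≤b (s≤s z≤n)

    compose-as-Σ : ∀ (f : U.Ser) a b N → suc (a +ℕ b) ≤ N →
                   S.compose f X a b ≈ Σ N (λ k → f k * P k a b)
    compose-as-Σ f a b N le = begin
      S.compose f X a b
        ≡⟨ sumTo≡Σ (suc (a +ℕ b)) _ ⟩
      Σ (suc (a +ℕ b)) (λ k → f k * S.bpow X k a b)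
        ≈⟨ Σ-cong (suc (a +ℕ b)) (λ k → *-congˡ (bpow≈pow X k a b)) ⟩
      Σ (suc (a +ℕ b)) (λ k → f k * P k a b)
        ≈⟨ U.Σ-extend (suc (a +ℕ b)) N _ le
             (λ k a+b<k _ → trans (*-congˡ (P-low-degree k a b a+b<k)) (zeroʳ _)) ⟨
      Σ N (λ k → f k * P k a b) ∎

    compose-split : ∀ (f : U.Ser) i j →
      S.compose f X i j ≈ f 0 * P 0 i j + Σ (i +ℕ j) (λ k → f (suc k) * P (suc k) i j)
    compose-split f i j = trans (compose-as-Σ f i j (suc (i +ℕ j)) ℕP.≤-refl) (Σ-suc (i +ℕ j) _)

    X-split : ∀ i j → X i j ≈ (y B.+s B.xMul FX) i j
    X-split i j = trans (sym (//-rightDividesˡ (S.tTimes FX i j) (X i j)))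
                        (+-cong (trans (X-eqn i j) (ySer≈y i j)) (tTimes≈xMul FX i j))
      where open GroupProperties +-group using (//-rightDividesˡ)

    power-recurrence : ∀ k i j → P (suc k) i j ≈ U.xMul (P k i) j + B.xMul (FX B.⋆ P k) i j
    power-recurrence k i j = begin
      (X B.⋆ P k) i j
        ≈⟨ B.⋆-cong {g = P k} X-split (λ _ _ → refl) i j ⟩
      ((y B.+s B.xMul FX) B.⋆ P k) i j
        ≈⟨ B.⋆-distribʳ y (B.xMul FX) (P k) i j ⟩
      (y B.⋆ P k) i j + (B.xMul FX B.⋆ P k) i j
        ≈⟨ +-cong (B.const-⋆ (U.xMul U.one) (P k) i j) (B.xMul-⋆ FX (P k) i j) ⟩
      (U.xMul U.one U.⋆ P k i) j + B.xMul (FX B.⋆ P k) i j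
        ≈⟨ +-congʳ (trans (U.xMul-⋆ U.one (P k i) j) (U.xMul-cong (U.⋆-identityˡ (P k i)) j)) ⟩
      U.xMul (P k i) j + B.xMul (FX B.⋆ P k) i j ∎

    FX⋆P : ∀ k i j → (FX B.⋆ P k) i j ≈ Σ (suc (i +ℕ j)) (λ m → F m * P (m +ℕ k) i j)
    FX⋆P k i j = begin
      (FX B.⋆ P k) i j
        ≡⟨ BΣ-at (suc i) _ j ⟩
      Σ (suc i) (λ a → Σ (suc j) (λ b → FX a b * P k (i ∸ a) (j ∸ b)))
        ≈⟨ Σ-cong< (suc i) (λ a a≤i → Σ-cong< (suc j) (λ b b≤j →
             trans (*-congʳ (compose-as-Σ F a b N (s≤s (ℕP.+-mono-≤ (ℕP.≤-pred a≤i) (ℕP.≤-pred b≤j)))))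
                   (trans (U.Σ-*ʳ N _ _) (Σ-cong N (λ m → *-assoc _ _ _))))) ⟩
      Σ (suc i) (λ a → Σ (suc j) (λ b → Σ N (λ m → F m * (P m a b * P k (i ∸ a) (j ∸ b)))))
        ≈⟨ Σ-cong (suc i) (λ a → U.Σ-swap (suc j) N _) ⟩
      Σ (suc i) (λ a → Σ N (λ m → Σ (suc j) (λ b → F m * (P m a b * P k (i ∸ a) (j ∸ b)))))
        ≈⟨ U.Σ-swap (suc i) N _ ⟩
      Σ N (λ m → Σ (suc i) (λ a → Σ (suc j) (λ b → F m * (P m a b * P k (i ∸ a) (j ∸ b)))))
        ≈⟨ Σ-cong N (λ m → trans (Σ-*ˡ (suc i) _ _) (Σ-cong (suc i) (λ a → Σ-*ˡ (suc j) _ _))) ⟨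
      Σ N (λ m → F m * Σ (suc i) (λ a → Σ (suc j) (λ b → P m a b * P k (i ∸ a) (j ∸ b))))
        ≈⟨ Σ-cong N (λ m → *-congˡ (trans (reflexive (P.sym (BΣ-at (suc i) _ j))) (sym (B.pow-+ X m k i j)))) ⟩
      Σ N (λ m → F m * P (m +ℕ k) i j) ∎
      where
      N = suc (i +ℕ j)

    P-y-free : ∀ k i → P (suc k) i 0 ≈ 0#
    P-y-free k zero    = trans (power-recurrence k 0 0) (+-identityˡ _)
    P-y-free k (suc i) = begin
      P (suc k) (suc i) 0
        ≈⟨ power-recurrence k (suc i) 0 ⟩
      0# + (FX B.⋆ P k) i 0
        ≈⟨ trans (+-identityˡ _) (FX⋆P k i 0) ⟩
      Σ (suc (i +ℕ 0)) (λ m → F m * P (m +ℕ k) i 0)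
        ≈⟨ Σ-suc (i +ℕ 0) _ ⟩
      0# * P k i 0 + Σ (i +ℕ 0) (λ m → F̂ m * P (suc m +ℕ k) i 0)
        ≈⟨ +-cong (zeroˡ _) (Σ-zero (i +ℕ 0) (λ m _ → trans (*-congˡ (P-y-free (m +ℕ k) i)) (zeroʳ _))) ⟩
      0# + 0#
        ≈⟨ +-identityˡ _ ⟩
      0# ∎

    P-t-free : ∀ m j → P m 0 j ≈ U.xMulPow m U.one j
    P-t-free zero    j = refl
    P-t-free (suc m) j = trans (power-recurrence m 0 j) (trans (+-identityʳ _) (U.xMul-cong (P-t-free m) j))

    A : ℕ → U.Ser
    A = U.pow F̂

    E : ℕ → ℕ → ℕ → Carrier
    E k i j = U.xMulPow k (A i) j

    Q : ℕ → ℕ → ℕ → Carrier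
    Q k i j = fact i * fact j * P k i j

    InversionAt : ℕ → ℕ → Set ℓ
    InversionAt i j = ∀ k → Q (suc k) i j ≈ ℕ→ (suc k) * fact (i +ℕ j ∸ 1) * E (suc k) i j

    inversion-y-free : ∀ i → InversionAt i 0
    inversion-y-free i k = trans (*-congˡ (P-y-free k i)) (trans (zeroʳ _) (sym (zeroʳ _)))

    inversion-t-free : ∀ j → InversionAt 0 (suc j)
    inversion-t-free j k = begin
      fact 0 * fact (suc j) * P (suc k) 0 (suc j)  ≈⟨ *-cong (trans (*-congʳ fact-zero) (*-identityˡ _))
                                                            (P-t-free (suc k) (suc j)) ⟩
      fact (suc j) * e                            ≈⟨ *-congʳ (fact-suc j) ⟩
      ℕ→ (suc j) * fact j * e                      ≈⟨ xy∙z≈y∙xz _ _ _ ⟩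
      fact j * (ℕ→ (suc j) * e)                    ≈⟨ *-congˡ (U.xMulPow-one-degree (suc k) (suc j)) ⟩
      fact j * (ℕ→ (suc k) * e)                    ≈⟨ xy∙z≈y∙xz _ _ _ ⟨
      ℕ→ (suc k) * fact j * e                      ∎
      where e = U.xMulPow (suc k) U.one (suc j)

    scaled-recurrence : ∀ k i j → Q (suc k) (suc i) (suc j) ≈
      ℕ→ (suc j) * Q k (suc i) j + ℕ→ (suc i) * Σ (suc (i +ℕ suc j)) (λ m → F m * Q (m +ℕ k) i (suc j))
    scaled-recurrence k i j = begin
      fact (suc i) * fact (suc j) * P (suc k) (suc i) (suc j)
        ≈⟨ *-congˡ (power-recurrence k (suc i) (suc j)) ⟩
      fact (suc i) * fact (suc j) * (P k (suc i) j + (FX B.⋆ P k) i (suc j))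
        ≈⟨ distribˡ _ _ _ ⟩
      fact (suc i) * fact (suc j) * P k (suc i) j + fact (suc i) * fact (suc j) * (FX B.⋆ P k) i (suc j)
        ≈⟨ +-cong y-part t-part ⟩
      ℕ→ (suc j) * Q k (suc i) j + ℕ→ (suc i) * Σ N (λ m → F m * Q (m +ℕ k) i (suc j)) ∎
      where
      N = suc (i +ℕ suc j)
      y-part : fact (suc i) * fact (suc j) * P k (suc i) j ≈ ℕ→ (suc j) * Q k (suc i) j
      y-part = trans (*-congʳ (*-congˡ (fact-suc j)))
        (solve 4 (λ a n b p → (a :* (n :* b)) :* p := n :* ((a :* b) :* p)) refl
               (fact (suc i)) (ℕ→ (suc j)) (fact j) (P k (suc i) j))
      t-part : fact (suc i) * fact (suc j) * (FX B.⋆ P k) i (suc j) ≈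
               ℕ→ (suc i) * Σ N (λ m → F m * Q (m +ℕ k) i (suc j))
      t-part = begin
        fact (suc i) * fact (suc j) * (FX B.⋆ P k) i (suc j)
          ≈⟨ *-cong (*-congʳ (fact-suc i)) (FX⋆P k i (suc j)) ⟩
        ℕ→ (suc i) * fact i * fact (suc j) * Σ N (λ m → F m * P (m +ℕ k) i (suc j))
          ≈⟨ solve 4 (λ n a b s → ((n :* a) :* b) :* s := n :* ((a :* b) :* s)) refl
                     (ℕ→ (suc i)) (fact i) (fact (suc j)) (Σ N (λ m → F m * P (m +ℕ k) i (suc j))) ⟩
        ℕ→ (suc i) * (fact i * fact (suc j) * Σ N (λ m → F m * P (m +ℕ k) i (suc j)))
          ≈⟨ *-congˡ (trans (Σ-*ˡ N _ _) (Σ-cong N (λ m → x∙yz≈y∙xz _ _ _))) ⟩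
        ℕ→ (suc i) * Σ N (λ m → F m * Q (m +ℕ k) i (suc j)) ∎

    -- W k i j = [x^(j+1)] x^(k+1) θF̂·F̂ⁱ, the part of the t·F(X)·X^k contribution
    -- coming from the derivative of F̂.
    W : ℕ → ℕ → ℕ → Carrier
    W k i j = U.xMulPow (suc k) (U.θ F̂ U.⋆ A i) (suc j)

    -- The weights (k+1+m)·F̂ₘ produced by the formula at (i, j+1) assemble into
    -- (k+1)·F̂^(i+1) + θF̂·F̂ⁱ after multiplication by F̂ⁱ.
    weights : ℕ → U.Ser
    weights k m = ℕ→ (suc k +ℕ m) * F̂ m

    weights-split : ∀ k i → (weights k U.⋆ A i) U.≈s (ℕ→ (suc k) U.·s A (suc i)) U.+s (U.θ F̂ U.⋆ A i)
    weights-split k i n = begin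
      (weights k U.⋆ A i) n
        ≈⟨ U.⋆-cong {g = A i} (λ m → trans (*-congʳ (ℕ→-+ (suc k) m)) (distribʳ _ _ _)) (λ _ → refl) n ⟩
      (((ℕ→ (suc k) U.·s F̂) U.+s U.θ F̂) U.⋆ A i) n
        ≈⟨ U.⋆-distribʳ _ _ (A i) n ⟩
      ((ℕ→ (suc k) U.·s F̂) U.⋆ A i) n + (U.θ F̂ U.⋆ A i) n
        ≈⟨ +-congʳ (U.⋆-scaleˡ _ F̂ (A i) n) ⟩
      ℕ→ (suc k) * A (suc i) n + (U.θ F̂ U.⋆ A i) n ∎

    -- With Z = (i+j)! and e = E k (i+1) j it
    -- follows from the Euler-operator identities (i+1)·W = [x^(j+1)] x^(k+1) θ(F̂^(i+1))
    -- and [x^(j+1)] x^(k+1) θ(F̂^(i+1)) + (k+1)·e = (j+1)·e.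
    step-identity : ∀ k i j → let Z = fact (i +ℕ j); e = E k (suc i) j in
      ℕ→ (suc j) * (ℕ→ k * Z * e) + ℕ→ (suc i) * (Z * (ℕ→ (suc k) * e + W k i j)) ≈
      ℕ→ (suc k) * fact (suc i +ℕ suc j ∸ 1) * e
    step-identity k i j = begin
      ℕ→ (suc j) * (ℕ→ k * Z * e) + ℕ→ (suc i) * (Z * (ℕ→ (suc k) * e + W k i j))
        ≈⟨ solve 6 (λ j₀ k₀ i₀ z e w →
             ((con 1 :+ j₀) :* ((k₀ :* z) :* e)) :+ ((con 1 :+ i₀) :* (z :* (((con 1 :+ k₀) :* e) :+ w)))
             := (((con 1 :+ j₀) :* ((k₀ :* z) :* e)) :+ (i₀ :* ((con 1 :+ k₀) :* (z :* e))))
                :+ (z :* (((con 1 :+ i₀) :* w) :+ ((con 1 :+ k₀) :* e))))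
             refl (ℕ→ j) (ℕ→ k) (ℕ→ i) Z e (W k i j) ⟩
      R + Z * (ℕ→ (suc i) * W k i j + ℕ→ (suc k) * e)
        ≈⟨ +-congˡ (*-congˡ (trans (+-congʳ θ-power) θ-shift)) ⟩
      R + Z * (ℕ→ (suc j) * e)
        ≈⟨ solve 5 (λ j₀ k₀ i₀ z e →
             (((con 1 :+ j₀) :* ((k₀ :* z) :* e)) :+ (i₀ :* ((con 1 :+ k₀) :* (z :* e))))
               :+ (z :* ((con 1 :+ j₀) :* e))
             := ((con 1 :+ k₀) :* ((con 1 :+ (i₀ :+ j₀)) :* z)) :* e)
             refl (ℕ→ j) (ℕ→ k) (ℕ→ i) Z e ⟩
      ℕ→ (suc k) * ((1# + (ℕ→ i + ℕ→ j)) * Z) * e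
        ≈⟨ *-congʳ (*-congˡ fact-total) ⟨
      ℕ→ (suc k) * fact (suc i +ℕ suc j ∸ 1) * e ∎
      where
      Z = fact (i +ℕ j)
      e = E k (suc i) j
      R = ℕ→ (suc j) * (ℕ→ k * Z * e) + ℕ→ i * (ℕ→ (suc k) * (Z * e))
      θ-power : ℕ→ (suc i) * W k i j ≈ U.xMulPow (suc k) (U.θ (A (suc i))) (suc j)
      θ-power = trans (sym (U.xMulPow-scale (suc k) _ _ (suc j)))
                      (U.xMulPow-cong (suc k) (λ n → sym (U.θ-pow F̂ i n)) (suc j))
      θ-shift : U.xMulPow (suc k) (U.θ (A (suc i))) (suc j) + ℕ→ (suc k) * e ≈ ℕ→ (suc j) * e
      θ-shift = U.xMulPow-θ (suc k) (A (suc i)) (suc j)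
      fact-total : fact (suc i +ℕ suc j ∸ 1) ≈ (1# + (ℕ→ i + ℕ→ j)) * Z
      fact-total = trans (reflexive (P.cong fact (ℕP.+-suc i j)))
                         (trans (fact-suc (i +ℕ j)) (*-congʳ (+-congˡ (ℕ→-+ i j))))

    inversion-step : ∀ {i j} → InversionAt (suc i) j → InversionAt i (suc j) → InversionAt (suc i) (suc j)
    inversion-step {i} {j} IH-y IH-t k = begin
      Q (suc k) (suc i) (suc j)
        ≈⟨ scaled-recurrence k i j ⟩
      ℕ→ (suc j) * Q k (suc i) j + ℕ→ (suc i) * Σ (suc (i +ℕ suc j)) (λ m → F m * Q (m +ℕ k) i (suc j))
        ≈⟨ +-cong (*-congˡ (y-contribution k)) (*-congˡ t-contribution) ⟩
      ℕ→ (suc j) * (ℕ→ k * Z * e) + ℕ→ (suc i) * (Z * (ℕ→ (suc k) * e + W k i j))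
        ≈⟨ step-identity k i j ⟩
      ℕ→ (suc k) * fact (suc i +ℕ suc j ∸ 1) * e ∎
      where
      Z = fact (i +ℕ j)
      e = E k (suc i) j

      y-contribution : ∀ k → Q k (suc i) j ≈ ℕ→ k * Z * E k (suc i) j
      y-contribution zero    = trans (zeroʳ _) (sym (trans (*-congʳ (zeroˡ _)) (zeroˡ _)))
      y-contribution (suc k) = IH-y k

      -- The t·F(X)·X^k part, from the formula at (i, j+1); F₀ = 0 removes m = 0.
      term : ∀ m → F (suc m) * Q (suc m +ℕ k) i (suc j) ≈
                   Z * (weights k m * U.xMulPow (suc k +ℕ m) (A i) (suc j))
      term m = begin
        F̂ m * Q (suc (m +ℕ k)) i (suc j)
          ≈⟨ *-congˡ (IH-t (m +ℕ k)) ⟩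
        F̂ m * (ℕ→ (suc (m +ℕ k)) * fact (i +ℕ suc j ∸ 1) * E (suc (m +ℕ k)) i (suc j))
          ≡⟨ P.cong₂ (λ d l → F̂ m * (ℕ→ (suc d) * fact l * U.xMulPow (suc d) (A i) (suc j)))
                     (ℕP.+-comm m k) (P.cong (_∸ 1) (ℕP.+-suc i j)) ⟩
        F̂ m * (ℕ→ (suc k +ℕ m) * Z * x)
          ≈⟨ solve 4 (λ f n z x → f :* ((n :* z) :* x) := z :* ((n :* f) :* x)) refl
                     (F̂ m) (ℕ→ (suc k +ℕ m)) Z x ⟩
        Z * (weights k m * x) ∎
        where x = U.xMulPow (suc k +ℕ m) (A i) (suc j)

      covers : suc (suc j) ≤ suc k +ℕ (i +ℕ suc j)
      covers = s≤s (ℕP.≤-trans (ℕP.m≤n+m (suc j) i) (ℕP.m≤n+m _ k))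

      t-contribution : Σ (suc (i +ℕ suc j)) (λ m → F m * Q (m +ℕ k) i (suc j)) ≈ Z * (ℕ→ (suc k) * e + W k i j)
      t-contribution = begin
        Σ (suc (i +ℕ suc j)) (λ m → F m * Q (m +ℕ k) i (suc j))
          ≈⟨ trans (Σ-suc (i +ℕ suc j) _) (trans (+-congʳ (zeroˡ _)) (+-identityˡ _)) ⟩
        Σ (i +ℕ suc j) (λ m → F (suc m) * Q (suc m +ℕ k) i (suc j))
          ≈⟨ Σ-cong (i +ℕ suc j) term ⟩
        Σ (i +ℕ suc j) (λ m → Z * (weights k m * U.xMulPow (suc k +ℕ m) (A i) (suc j)))
          ≈⟨ Σ-*ˡ (i +ℕ suc j) Z _ ⟨
        Z * Σ (i +ℕ suc j) (λ m → weights k m * U.xMulPow (suc k +ℕ m) (A i) (suc j))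
          ≈⟨ *-congˡ (U.xMulPow-Σ (suc k) (i +ℕ suc j) (weights k) (A i) (suc j) covers) ⟩
        Z * U.xMulPow (suc k) (weights k U.⋆ A i) (suc j)
          ≈⟨ *-congˡ (trans (U.xMulPow-cong (suc k) (weights-split k i) (suc j))
                            (trans (U.xMulPow-+ (suc k) _ _ (suc j))
                                   (+-congʳ (U.xMulPow-scale (suc k) _ (A (suc i)) (suc j))))) ⟩
        Z * (ℕ→ (suc k) * e + W k i j) ∎

    inversion : ∀ i j → InversionAt i j
    inversion i       zero    = inversion-y-free i
    inversion zero    (suc j) = inversion-t-free j
    inversion (suc i) (suc j) = inversion-step (inversion (suc i) j) (inversion i (suc j))

    riordan-entry : ∀ G i j → S.riordan G F (j +ℕ i) i ≈ (G U.⋆ A i) j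
    riordan-entry G i j = begin
      S.riordan G F (j +ℕ i) i            ≡⟨ sumTo≡Σ (suc (j +ℕ i)) _ ⟩
      (G U.⋆ S.pow F i) (j +ℕ i)          ≈⟨ U.⋆-congˡ G (λ n → trans (pow≈pow F i n)
                                               (U.pow-cong i (xTimes≈xMul F̂) n)) (j +ℕ i) ⟩
      (G U.⋆ U.pow (U.xMul F̂) i) (j +ℕ i) ≈⟨ U.⋆-congˡ G (U.pow-xMul F̂ i) (j +ℕ i) ⟩
      (G U.⋆ U.xMulPow i (A i)) (j +ℕ i)  ≈⟨ U.⋆-comm G _ (j +ℕ i) ⟩
      (U.xMulPow i (A i) U.⋆ G) (j +ℕ i)  ≈⟨ U.xMulPow-⋆ i (A i) G (j +ℕ i) ⟩
      U.xMulPow i (A i U.⋆ G) (j +ℕ i)    ≡⟨ P.trans (U.xMulPow-≤ i (j +ℕ i) _ (ℕP.m≤n+m i j))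
                                                    (P.cong (A i U.⋆ G) (ℕP.m+n∸n≡m j i)) ⟩
      (A i U.⋆ G) j                       ≈⟨ U.⋆-comm (A i) G j ⟩
      (G U.⋆ A i) j                       ∎

    scaled-LGDR : ∀ G i j → fact i * fact (suc j) * S.LGDR G F i (suc j) ≈ fact (j +ℕ i) * (G U.⋆ A i) j
    scaled-LGDR G i j = begin
      fact i * fact (suc j) * (ℕ→ ((j +ℕ i) C i) * S.riordan G F (j +ℕ i) i * S.inv-suc j)
        ≈⟨ *-cong (*-congˡ (fact-suc j)) (*-congʳ (*-congˡ (riordan-entry G i j))) ⟩
      fact i * (ℕ→ (suc j) * fact j) * (ℕ→ ((j +ℕ i) C i) * g * S.inv-suc j)
        ≈⟨ solve 6 (λ a n b c s v → (a :* (n :* b)) :* ((c :* s) :* v) := ((a :* b) :* c) :* (n :* (s :* v)))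
                   refl (fact i) (ℕ→ (suc j)) (fact j) (ℕ→ ((j +ℕ i) C i)) g (S.inv-suc j) ⟩
      fact i * fact j * ℕ→ ((j +ℕ i) C i) * (ℕ→ (suc j) * (g * S.inv-suc j))
        ≈⟨ *-cong (fact-binomial i j) (inv-suc-cancel j g) ⟩
      fact (j +ℕ i) * g ∎
      where g = (G U.⋆ A i) j

    scaled-integral : ∀ G i j →
      fact i * fact (suc j) * S.compose (S.integral G) X i (suc j) ≈ fact (j +ℕ i) * (G U.⋆ A i) j
    scaled-integral G i j = begin
      w * S.compose (S.integral G) X i (suc j)
        ≈⟨ *-congˡ (trans (compose-split (S.integral G) i (suc j)) (trans (+-congʳ (zeroˡ _)) (+-identityˡ _))) ⟩
      w * Σ (i +ℕ suc j) (λ k → G k * S.inv-suc k * P (suc k) i (suc j))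
        ≈⟨ Σ-*ˡ (i +ℕ suc j) w _ ⟩
      Σ (i +ℕ suc j) (λ k → w * (G k * S.inv-suc k * P (suc k) i (suc j)))
        ≈⟨ Σ-cong (i +ℕ suc j) term ⟩
      Σ (i +ℕ suc j) (λ k → Z * (G k * E k i j))
        ≈⟨ Σ-*ˡ (i +ℕ suc j) Z _ ⟨
      Z * Σ (i +ℕ suc j) (λ k → G k * E k i j)
        ≈⟨ *-congˡ (U.xMulPow-Σ 0 (i +ℕ suc j) G (A i) j (ℕP.m≤n+m (suc j) i)) ⟩
      Z * (G U.⋆ A i) j
        ≡⟨ P.cong (λ n → fact n * (G U.⋆ A i) j) (P.trans (P.cong (_∸ 1) (ℕP.+-suc i j)) (ℕP.+-comm i j)) ⟩
      fact (j +ℕ i) * (G U.⋆ A i) j ∎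
      where
      w = fact i * fact (suc j)
      Z = fact (i +ℕ suc j ∸ 1)
      term : ∀ k → w * (G k * S.inv-suc k * P (suc k) i (suc j)) ≈ Z * (G k * E k i j)
      term k = begin
        w * (G k * S.inv-suc k * P (suc k) i (suc j))
          ≈⟨ x∙yz≈y∙xz _ _ _ ⟩
        G k * S.inv-suc k * Q (suc k) i (suc j)
          ≈⟨ *-congˡ (inversion i (suc j) k) ⟩
        G k * S.inv-suc k * (ℕ→ (suc k) * Z * E (suc k) i (suc j))
          ≈⟨ solve 5 (λ g v n z e → (g :* v) :* ((n :* z) :* e) := (z :* (n :* ((g :* e) :* v))))
                     refl (G k) (S.inv-suc k) (ℕ→ (suc k)) Z (E k i j) ⟩
        Z * (ℕ→ (suc k) * (G k * E k i j * S.inv-suc k))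
          ≈⟨ *-congˡ (inv-suc-cancel k _) ⟩
        Z * (G k * E k i j) ∎

    integral-composition : ∀ G i j → S.LGDR G F i j ≈ S.compose (S.integral G) X i j
    integral-composition G i zero    = sym (begin
      S.compose (S.integral G) X i 0
        ≈⟨ compose-split (S.integral G) i 0 ⟩
      0# * P 0 i 0 + Σ (i +ℕ 0) (λ k → S.integral G (suc k) * P (suc k) i 0)
        ≈⟨ +-cong (zeroˡ _) (Σ-zero (i +ℕ 0) (λ k _ → trans (*-congˡ (P-y-free k i)) (zeroʳ _))) ⟩
      0# + 0#
        ≈⟨ +-identityˡ _ ⟩
      0# ∎)
    integral-composition G i (suc j) =
      cancel-factorials i (suc j) (trans (scaled-LGDR G i j) (sym (scaled-integral G i j)))

    -- First form of the theorem: any antiderivative H of G gives LGD̂R = H(X) - H(0),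
    -- since H and ∫G agree beyond the constant term.
    antiderivative-composition : ∀ G (H : U.Ser) → (∀ n → ℕ→ (suc n) * H (suc n) ≈ G n) →
      ∀ i j → S.LGDR G F i j ≈ S.compose H X i j - S.bconst (H 0) i j
    antiderivative-composition G H H′≈G i j = begin
      S.LGDR G F i j
        ≈⟨ integral-composition G i j ⟩
      S.compose (S.integral G) X i j
        ≈⟨ compose-split (S.integral G) i j ⟩
      0# * P 0 i j + Σ (i +ℕ j) (λ k → S.integral G (suc k) * P (suc k) i j)
        ≈⟨ trans (+-congʳ (zeroˡ _)) (+-identityˡ _) ⟩
      Σ (i +ℕ j) (λ k → S.integral G (suc k) * P (suc k) i j)
        ≈⟨ Σ-cong (i +ℕ j) (λ k → *-congʳ (H-coefficient k)) ⟨
      tail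
        ≈⟨ xyx⁻¹≈y (S.bconst (H 0) i j) tail ⟨
      S.bconst (H 0) i j + tail - S.bconst (H 0) i j
        ≈⟨ +-congʳ (+-congʳ (H₀-term i j)) ⟨
      H 0 * P 0 i j + tail - S.bconst (H 0) i j
        ≈⟨ +-congʳ (compose-split H i j) ⟨
      S.compose H X i j - S.bconst (H 0) i j ∎
      where
      open import Algebra.Properties.AbelianGroup +-abelianGroup using (xyx⁻¹≈y)
      tail = Σ (i +ℕ j) (λ k → H (suc k) * P (suc k) i j)
      H-coefficient : ∀ k → H (suc k) ≈ S.integral G (suc k)
      H-coefficient k = cancel-ℕ (suc k) (trans (H′≈G k) (sym (inv-suc-cancel k (G k))))
      H₀-term : ∀ i j → H 0 * P 0 i j ≈ S.bconst (H 0) i j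
      H₀-term zero    zero    = *-identityʳ _
      H₀-term zero    (suc j) = zeroʳ _
      H₀-term (suc i) j       = zeroʳ _

proposition2 : {c ℓ : Level} (K : CharZeroField c ℓ) →
    let open CharZeroField K
        open Series K
    in (G Fhat : ℕ → Carrier) → G 0 ≈ 1# → ¬ (Fhat 0 ≈ 0#) →
       (X : ℕ → ℕ → Carrier) → X 0 0 ≈ 0# →
       (∀ i j → X i j - tTimes (compose (xTimes Fhat) X) i j ≈ ySer i j) →
       (H : ℕ → Carrier) → (∀ n → fromℕ (suc n) * H (suc n) ≈ G n) →
       (∀ i j → LGDR G (xTimes Fhat) i j ≈ compose H X i j - bconst (H 0) i j)
       × (∀ i j → LGDR G (xTimes Fhat) i j ≈ compose (integral G) X i j)
proposition2 K G F̂ _ _ X X₀₀ X-eqn H H′≈G =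
  antiderivative-composition G H H′≈G , integral-composition G
  where open Inversion.Lagrange K F̂ X X₀₀ X-eqn
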